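{- For every $n\geq 1$ and every Dyck path $p$ of length $2n$, we have $h(g_0(p))=g_1(h(p))$.
   Context: Lattice paths are sequences of steps $\nearrow$ (upstep $(+1,+1)$) and $\searrow$ (downstep $(+1,-1)$); $\circ$ denotes concatenation and $()$ the empty path. A Dyck path of length $2m$ is a path with $m$ upsteps and $m$ downsteps that, started at height $0$, never goes below height $0$; $()$ is the Dyck path of length $0$. For a nonempty Dyck path $p$ of length $2n$, let $x$ be the smallest positive abscissa at which $p$ returns to height $0$; then $p=(\nearrow)\circ\ell(p)\circ(\searrow)\circ r(p)$ where $\ell(p)$ consists of steps $2,\ldots,x-1$ of $p$ and $r(p)$ of steps $x+1,\ldots,2n$ (both Dyck paths, possibly empty). For a path $q$ of even length $2m$, $\pi_1(q)$ is obtained by swapping the steps at positions $2i$ and $2i+1$ for every $i=1,\ldots,m-1$ (and $\pi_1(())=()$). Define $g_0(p):=\ell(p)\circ(\nearrow)\circ r(p)\circ(\searrow)$ and $g_1(p):=\pi_1(\ell(p))\circ(\nearrow)\circ\pi_1(r(p))\circ(\searrow)$. Define $h$ on Dyck paths recursively: $h(()):=()$; if $p=(\nearrow)\circ p'\circ(\searrow)$ with $p'$ a Dyck path (i.e. $p$ returns to height $0$ only at its end), then $h(p):=(\nearrow)\circ\pi_1(h(p'))\circ(\searrow)$; otherwise write $p=p_1\circ p_2$ with $p_1,p_2$ nonempty Dyck paths and set $h(p):=h(p_1)\circ h(p_2)$ (this is independent of the chosen decomposition). -}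

module Defs where

open import Data.Nat using (ℕ; zero; suc)
open import Data.List using (List; []; _∷_; _++_; [_]; length)
open import Data.Product using (_×_; _,_; proj₁; proj₂)
open import Data.Unit using (⊤)
open import Data.Empty using (⊥)

-- Steps: U = upstep ↗ (+1,+1), D = downstep ↘ (+1,-1). Paths are lists of steps,
-- concatenation ∘ is _++_, the empty path () is [].
data Step : Set where
  U D : Step

Path : Set
Path = List Step

-- DyckFrom k p : started at height k, p never goes below 0 and ends at height 0.
DyckFrom : ℕ → Path → Set
DyckFrom zero    []       = ⊤
DyckFrom (suc k) []       = ⊥
DyckFrom k       (U ∷ xs) = DyckFrom (suc k) xs
DyckFrom zero    (D ∷ xs) = ⊥
DyckFrom (suc k) (D ∷ xs) = DyckFrom k xs

IsDyck : Path → Set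
IsDyck = DyckFrom 0

-- scan k xs: xs is read at relative height k above the level of the first
-- return; returns (steps before the first step going from height 1 to 0,
-- steps after it).
scan : ℕ → Path → Path × Path
scan k       []       = [] , []
scan k       (U ∷ xs) = let r = scan (suc k) xs in (U ∷ proj₁ r) , proj₂ r
scan zero    (D ∷ xs) = [] , xs
scan (suc k) (D ∷ xs) = let r = scan k xs in (D ∷ proj₁ r) , proj₂ r

-- First-return decomposition p = ↗ ∘ ℓ(p) ∘ ↘ ∘ r(p) (for nonempty Dyck p;
-- junk value [] otherwise).
ℓ : Path → Path
ℓ (U ∷ xs) = proj₁ (scan 0 xs)
ℓ _        = []

r : Path → Path
r (U ∷ xs) = proj₂ (scan 0 xs)
r _        = []

-- π₁: swap the steps at positions 2i and 2i+1 (1-indexed), i = 1..m-1.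
swapPairs : Path → Path
swapPairs (a ∷ b ∷ xs) = b ∷ a ∷ swapPairs xs
swapPairs xs           = xs

π₁ : Path → Path
π₁ []       = []
π₁ (x ∷ xs) = x ∷ swapPairs xs

g₀ : Path → Path
g₀ p = ℓ p ++ (U ∷ r p ++ [ D ])

g₁ : Path → Path
g₁ p = π₁ (ℓ p) ++ (U ∷ π₁ (r p) ++ [ D ])

-- h, computed via the first-return decomposition p = (↗ ∘ ℓ(p) ∘ ↘) ∘ r(p):
--   h(p) = h(↗ ℓ(p) ↘) ∘ h(r(p)) = ↗ ∘ π₁(h(ℓ(p))) ∘ ↘ ∘ h(r(p)),
-- which agrees with the paper's recursive definition (independence of the
-- decomposition).  Recursion is on a fuel argument (the length suffices).
hF : ℕ → Path → Path
hF zero    p        = []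
hF (suc f) []       = []
hF (suc f) (U ∷ xs) = U ∷ π₁ (hF f (ℓ (U ∷ xs))) ++ (D ∷ hF f (r (U ∷ xs)))
hF (suc f) (D ∷ xs) = []

h : Path → Path
h p = hF (length p) p

module Submission where

open import Defs
open import Data.Nat using (ℕ; zero; suc; _+_; _*_; _≤_; z≤n; s≤s)
open import Data.Nat.Properties using (≤-trans; ≤-refl; n≤1+n)
open import Data.List using ([]; _∷_; _++_; [_]; length)
open import Data.List.Properties using (++-assoc)
open import Data.Product using (Σ-syntax; _×_; _,_; proj₁; proj₂)
open import Data.Unit using (tt)
open import Relation.Binary.PropositionalEquality
  using (_≡_; refl; sym; cong; cong₂; module ≡-Reasoning)

-- Write a nonempty Dyck path as p = ↗ x ↘ y with x, y Dyck
-- (first-return decomposition).  Then g₀ p = x ↗ y ↘, and h turns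
-- concatenations of Dyck paths into concatenations and primitive paths
-- ↗ x ↘ into ↗ π₁(h x) ↘.  Hence
--   h (g₀ p) = h x ∘ ↗ π₁(h y) ↘
--   h p      = ↗ π₁(h x) ↘ h y,   so   g₁ (h p) = π₁(π₁(h x)) ∘ ↗ π₁(h y) ↘,
-- and the two agree because π₁ is an involution.  The only subtlety is
-- that g₁ re-decomposes h p, which needs π₁(h x) to be Dyck, i.e. h produces
-- Dyck paths and π₁ preserves Dyck paths.

-- An upstep from height k leads to height k + 1 (for every k, not only
-- for the cases where `DyckFrom` computes).
up-intro : ∀ k xs → DyckFrom (suc k) xs → DyckFrom k (U ∷ xs)
up-intro zero    xs d = d
up-intro (suc k) xs d = d

up-elim : ∀ k xs → DyckFrom k (U ∷ xs) → DyckFrom (suc k) xs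
up-elim zero    xs d = d
up-elim (suc k) xs d = d

dyck-++ : ∀ k m a b → DyckFrom k a → DyckFrom m b → DyckFrom (k + m) (a ++ b)
dyck-++ zero    m []      b da db = db
dyck-++ k       m (U ∷ a) b da db =
  up-intro (k + m) (a ++ b) (dyck-++ (suc k) m a b (up-elim k a da) db)
dyck-++ (suc k) m (D ∷ a) b da db = dyck-++ k m a b da db

-- If x descends from height k to 0 without going below 0, then `scan k`
-- splits x ↘ y exactly after x: the final ↘ is the first step below 0.
scan-split : ∀ k x y → DyckFrom k x → scan k (x ++ D ∷ y) ≡ (x , y)
scan-split zero    []      y d = refl
scan-split k       (U ∷ x) y d
  rewrite scan-split (suc k) x y (up-elim k x d) = refl
scan-split (suc k) (D ∷ x) y d rewrite scan-split k x y d = refl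

first-return : ∀ k xs → DyckFrom (suc k) xs →
  Σ[ x ∈ Path ] Σ[ y ∈ Path ] (xs ≡ x ++ D ∷ y) × DyckFrom k x × IsDyck y
first-return k (U ∷ xs) d with first-return (suc k) xs d
... | x , y , refl , dx , dy = U ∷ x , y , refl , up-intro k x dx , dy
first-return zero    (D ∷ xs) d = [] , xs , refl , tt , d
first-return (suc k) (D ∷ xs) d with first-return k xs d
... | x , y , refl , dx , dy = D ∷ x , y , refl , dx , dy

ℓr-split : ∀ x y → IsDyck x → (ℓ (U ∷ x ++ D ∷ y) , r (U ∷ x ++ D ∷ y)) ≡ (x , y)
ℓr-split x y = scan-split 0 x y

swapPairs-involutive : ∀ xs → swapPairs (swapPairs xs) ≡ xs
swapPairs-involutive []           = refl
swapPairs-involutive (a ∷ [])     = refl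
swapPairs-involutive (a ∷ b ∷ xs) = cong (λ zs → a ∷ b ∷ zs) (swapPairs-involutive xs)

π₁-involutive : ∀ xs → π₁ (π₁ xs) ≡ xs
π₁-involutive []       = refl
π₁-involutive (x ∷ xs) = cong (x ∷_) (swapPairs-involutive xs)

-- double j = 2j, so that suc (double j) enumerates the odd heights.
double : ℕ → ℕ
double zero    = zero
double (suc j) = suc (suc (double j))

-- Read from an odd height, swapping two consecutive steps only changes the
-- height between them, from odd ± 1 to odd ∓ 1, which is never negative.
swapPairs-dyck : ∀ j xs → DyckFrom (suc (double j)) xs →
                 DyckFrom (suc (double j)) (swapPairs xs)
swapPairs-dyck j       []           d = d
swapPairs-dyck j       (a ∷ [])     d = d
swapPairs-dyck j       (U ∷ U ∷ xs) d = swapPairs-dyck (suc j) xs d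
swapPairs-dyck zero    (D ∷ D ∷ xs) ()
swapPairs-dyck (suc j) (D ∷ D ∷ xs) d = swapPairs-dyck j xs d
swapPairs-dyck j       (U ∷ D ∷ xs) d = up-intro (double j) _ (swapPairs-dyck j xs d)
swapPairs-dyck j       (D ∷ U ∷ xs) d = swapPairs-dyck j xs (up-elim (double j) xs d)

-- π₁ keeps the first step of a Dyck path, after which the height is 1.
π₁-dyck : ∀ p → IsDyck p → IsDyck (π₁ p)
π₁-dyck []       d = d
π₁-dyck (U ∷ xs) d = swapPairs-dyck zero xs d

-- The two parts produced by `scan` are no longer than the input; this bounds
-- the recursive calls of hF.
scan-length₁ : ∀ k xs → length (proj₁ (scan k xs)) ≤ length xs
scan-length₁ k       []       = z≤n
scan-length₁ k       (U ∷ xs) = s≤s (scan-length₁ (suc k) xs)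
scan-length₁ zero    (D ∷ xs) = z≤n
scan-length₁ (suc k) (D ∷ xs) = s≤s (scan-length₁ k xs)

scan-length₂ : ∀ k xs → length (proj₂ (scan k xs)) ≤ length xs
scan-length₂ k       []       = z≤n
scan-length₂ k       (U ∷ xs) = ≤-trans (scan-length₂ (suc k) xs) (n≤1+n _)
scan-length₂ zero    (D ∷ xs) = n≤1+n _
scan-length₂ (suc k) (D ∷ xs) = ≤-trans (scan-length₂ k xs) (n≤1+n _)

-- Any fuel at least the length of the path gives the same value of hF,
-- since ℓ and r of ↗ xs are no longer than xs.
hF-fuel : ∀ f g p → length p ≤ f → length p ≤ g → hF f p ≡ hF g p
hF-fuel zero    zero    p        _       _       = refl
hF-fuel zero    (suc g) []       _       _       = refl
hF-fuel (suc f) zero    []       _       _       = refl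
hF-fuel (suc f) (suc g) []       _       _       = refl
hF-fuel (suc f) (suc g) (D ∷ xs) _       _       = refl
hF-fuel (suc f) (suc g) (U ∷ xs) (s≤s a) (s≤s b) =
  cong₂ (λ u v → U ∷ π₁ u ++ D ∷ v)
    (hF-fuel f g _ (≤-trans (scan-length₁ 0 xs) a) (≤-trans (scan-length₁ 0 xs) b))
    (hF-fuel f g _ (≤-trans (scan-length₂ 0 xs) a) (≤-trans (scan-length₂ 0 xs) b))

length-left : ∀ (x : Path) y → length x ≤ length (x ++ D ∷ y)
length-left []      y = z≤n
length-left (a ∷ x) y = s≤s (length-left x y)

length-right : ∀ (x : Path) y → length y ≤ length (x ++ D ∷ y)
length-right []      y = n≤1+n _
length-right (a ∷ x) y = ≤-trans (length-right x y) (n≤1+n _)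

h-first-return : ∀ x y → IsDyck x → h (U ∷ x ++ D ∷ y) ≡ U ∷ π₁ (h x) ++ D ∷ h y
h-first-return x y dx rewrite scan-split 0 x y dx =
  cong₂ (λ u v → U ∷ π₁ u ++ D ∷ v)
    (hF-fuel _ _ x (length-left x y) ≤-refl)
    (hF-fuel _ _ y (length-right x y) ≤-refl)

h-++ : ∀ n a b → length a ≤ n → IsDyck a → IsDyck b → h (a ++ b) ≡ h a ++ h b
h-++ n       []       b _       da db = refl
h-++ (suc n) (U ∷ xs) b (s≤s le) da db with first-return 0 xs da
... | x , y , refl , dx , dy = begin
  h (U ∷ (x ++ D ∷ y) ++ b)          ≡⟨ cong (λ z → h (U ∷ z)) (++-assoc x (D ∷ y) b) ⟩
  h (U ∷ x ++ D ∷ y ++ b)            ≡⟨ h-first-return x (y ++ b) dx ⟩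
  U ∷ π₁ (h x) ++ D ∷ h (y ++ b)     ≡⟨ cong (λ v → U ∷ π₁ (h x) ++ D ∷ v) ih ⟩
  U ∷ π₁ (h x) ++ D ∷ h y ++ h b     ≡⟨ sym (++-assoc (U ∷ π₁ (h x)) (D ∷ h y) (h b)) ⟩
  (U ∷ π₁ (h x) ++ D ∷ h y) ++ h b   ≡⟨ cong (_++ h b) (sym (h-first-return x y dx)) ⟩
  h (U ∷ x ++ D ∷ y) ++ h b          ∎
  where
  open ≡-Reasoning
  ih : h (y ++ b) ≡ h y ++ h b
  ih = h-++ n y b (≤-trans (length-right x y) le) dy db

hF-dyck : ∀ f p → IsDyck (hF f p)
hF-dyck zero    p        = tt
hF-dyck (suc f) []       = tt
hF-dyck (suc f) (D ∷ xs) = tt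
hF-dyck (suc f) (U ∷ xs) =
  dyck-++ 0 1 (π₁ (hF f (ℓ (U ∷ xs)))) (D ∷ hF f (r (U ∷ xs)))
    (π₁-dyck (hF f (ℓ (U ∷ xs))) (hF-dyck f (ℓ (U ∷ xs))))
    (hF-dyck f (r (U ∷ xs)))

h-dyck : ∀ p → IsDyck (h p)
h-dyck p = hF-dyck (length p) p

g₀-split : ∀ x y → IsDyck x → g₀ (U ∷ x ++ D ∷ y) ≡ x ++ U ∷ y ++ [ D ]
g₀-split x y dx = cong (λ s → proj₁ s ++ U ∷ proj₂ s ++ [ D ]) (ℓr-split x y dx)

g₁-split : ∀ x y → IsDyck x → g₁ (U ∷ x ++ D ∷ y) ≡ π₁ x ++ U ∷ π₁ y ++ [ D ]
g₁-split x y dx = cong (λ s → π₁ (proj₁ s) ++ U ∷ π₁ (proj₂ s) ++ [ D ]) (ℓr-split x y dx)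

lemma16 : ∀ (n : ℕ) → 1 ≤ n → (p : Path) → IsDyck p → length p ≡ 2 * n →
    h (g₀ p) ≡ g₁ (h p)
lemma16 (suc n) _ []       _ ()
lemma16 n       _ (U ∷ xs) d _ with first-return 0 xs d
... | x , y , refl , dx , dy = begin
  h (g₀ (U ∷ x ++ D ∷ y))                 ≡⟨ cong h (g₀-split x y dx) ⟩
  h (x ++ U ∷ y ++ [ D ])                 ≡⟨ h-++ _ x _ ≤-refl dx (dyck-++ 0 1 y [ D ] dy tt) ⟩
  h x ++ h (U ∷ y ++ [ D ])               ≡⟨ cong (h x ++_) (h-first-return y [] dy) ⟩
  h x ++ U ∷ π₁ (h y) ++ [ D ]            ≡⟨ cong (_++ U ∷ π₁ (h y) ++ [ D ]) (sym (π₁-involutive (h x))) ⟩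
  π₁ (π₁ (h x)) ++ U ∷ π₁ (h y) ++ [ D ]  ≡⟨ sym (g₁-split (π₁ (h x)) (h y) (π₁-dyck (h x) (h-dyck x))) ⟩
  g₁ (U ∷ π₁ (h x) ++ D ∷ h y)            ≡⟨ cong g₁ (sym (h-first-return x y dx)) ⟩
  g₁ (h (U ∷ x ++ D ∷ y))                 ∎
  where open ≡-Reasoning
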